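{- Let $\mathcal{T}=(T,\sigma,1)$ be a singly-seeded temperature-1 TAS with set of points of competition $P$, let $Y\subseteq P$ be an $r$-element set ($r\ge 1$) and $w:Y\to T$ a winner function. Assume $\mathcal{T}$ is directionally deterministic and $\alpha$ is the unique $w$-correct $\mathcal{T}$-terminal assembly. Then for every finite, $w$-correct, $\mathcal{T}$-producing assembly sequence $\vec\beta$ whose result is not in $\mathcal{A}_\Box[\mathcal{T}]$, there exists an extension $\vec\alpha$ of $\vec\beta$ by some $\mathcal{T}$-assembly sequence such that $\vec\alpha$ results in $\alpha$.
   Context: aTAM at temperature 1: tile types are unit squares with glues (label, strength) on their sides; a configuration is a partial map $\alpha:\mathbb{Z}^2\dashrightarrow T$; adjacent tiles bind if facing glues are equal with positive strength; $G^b_\alpha$ is the binding graph. $\alpha,\beta$ agree if equal on common domain. $\beta=\alpha+(\vec p,t)$ denotes a valid attachment step; if the new tile binds with total strength 1 to the tile at $\vec p\,'$, write $\vec u_{\beta\setminus\alpha}=\vec p\,'-\vec p$. A $\mathcal{T}$-assembly sequence is a finite or infinite sequence of assemblies each obtained from the previous one by a valid attachment step; it is $\mathcal{T}$-producing if it starts with $\sigma$; its result is the union (limit) of its assemblies; an extension of a finite sequence $\vec\beta$ is a sequence having $\vec\beta$ as a prefix. $\mathcal{A}[\mathcal{T}]$: producible assemblies; $\mathcal{A}_\Box[\mathcal{T}]$: producible terminal ones (no tile can attach). With $\vec s$ the seed point: for $\vec x\ne\vec y$ and finite simple grid paths $\pi,\pi'$ from $\vec x$ to $\vec y$, they compete for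 $\vec y$ from $\vec x$ if (1) $\pi\ne\pi'$; (2) $\mathrm{dom}\,\pi\cap\mathrm{dom}\,\pi'=\{\vec x,\vec y\}$; (3) one of them is a simple path in $G^b_\alpha$ for some $\alpha\in\mathcal{A}[\mathcal{T}]$; (4) for all $\alpha\in\mathcal{A}[\mathcal{T}]$, $p\in\{\pi,\pi'\}$, $1\le l<|p|$, and simple paths $p'$ from $\vec s$ to $p[l]$ in $G^b_\alpha$: if $p'$ goes through $p[1]$ then $p[1..l]$ is a suffix of $p'$, else $p'$ is a prefix of every simple path from $\vec s$ to $p[1]$ in $G^b_\alpha$; (5) for all $\alpha\in\mathcal{A}[\mathcal{T}]$ every simple path from $\vec s$ to $\vec y$ in $G^b_\alpha$ has $\pi$ or $\pi'$ as a suffix; (6) for all $\alpha\in\mathcal{A}[\mathcal{T}]$ with $\vec x\in\mathrm{dom}\,\alpha$: (a) for each $p\in\{\pi,\pi'\}$ some attachment sequence starting from $\{(\vec x,\alpha(\vec x))\}$ ends with an assembly of domain $\mathrm{dom}\,p$, (b) every attachment sequence starting from $\{(\vec x,\alpha(\vec x))\}$ has only $\pi,\pi'$ as simple paths from $\vec x$ to $\vec y$ in the binding graph of its final assembly. $\vec y$ is a point of competition (POC) if such $\vec x,\pi,\pi'$ exist; $P$ is the set of POCs. A winner function is $w:Y\to T$ for an $r$-element $Y\subseteq P$. $\alpha\in\mathcal{A}[\mathcal{T}]$ is $w$-correct if $\alpha(\vec p)=w(\vec p)$ for $\vec p\in\mathrm{dom}\,\alpha\cap Y$ and $\mathrm{dom}\,\alpha\cap(P\setminus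 Y)=\emptyset$; an assembly sequence is $w$-correct if its result is. A point $\vec p$ is directionally deterministic if it is the seed point or, for all $\alpha,\beta\in\mathcal{A}[\mathcal{T}]$, $t_\alpha,t_\beta$ with $\alpha'=\alpha+(\vec p,t_\alpha)$, $\beta'=\beta+(\vec p,t_\beta)$ valid: (i) if $\vec p\in P$ and $t_\alpha\ne t_\beta$, then $\vec u_{\alpha'\setminus\alpha}\ne\vec u_{\beta'\setminus\beta}$ or $\alpha(\vec p+\vec u_{\alpha'\setminus\alpha})\ne\beta(\vec p+\vec u_{\beta'\setminus\beta})$; (ii) if $\vec p\notin P$ and $t_\alpha\ne t_\beta$, then $\alpha,\beta$ do not agree. $\mathcal{T}$ is directionally deterministic if all points in domains of producible assemblies are. -}

module Defs where

open import Level using (0ℓ)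
open import Data.Nat using (ℕ; zero; suc; _+_; _≤_; _<_; _∸_)
open import Data.Nat.Properties using () renaming (_≟_ to _≟ℕ_)
open import Data.Integer using (ℤ; +_; -[1+_]) renaming (_+_ to _+ℤ_; _≟_ to _≟ℤ_)
open import Data.Fin using (Fin)
open import Data.Product using (Σ; ∃; ∃₂; _×_; _,_; proj₁; proj₂)
open import Data.Product.Properties using (≡-dec)
open import Data.Sum using (_⊎_)
open import Data.Maybe using (Maybe; just; nothing)
open import Data.Unit using (⊤)
open import Data.List using (List; []; _∷_; _++_; length; take; drop; head; last)
open import Data.List.Membership.Propositional using (_∈_)
open import Data.List.Relation.Unary.Unique.Propositional using (Unique)
open import Data.List.Relation.Unary.Linked using (Linked)
open import Relation.Binary.PropositionalEquality using (_≡_; _≢_; _≗_)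
open import Relation.Binary.Construct.Closure.ReflexiveTransitive using (Star)
open import Relation.Nullary using (¬_; yes; no)

Pt : Set
Pt = ℤ × ℤ

data Dir : Set where
  N E S W : Dir

vec : Dir → Pt
vec N = (+ 0 , + 1)
vec E = (+ 1 , + 0)
vec S = (+ 0 , -[1+ 0 ])
vec W = (-[1+ 0 ] , + 0)

opp : Dir → Dir
opp N = S
opp E = W
opp S = N
opp W = E

_⊕_ : Pt → Pt → Pt
(a , b) ⊕ (c , d) = (a +ℤ c , b +ℤ d)

_≟Pt_ : (p q : Pt) → Relation.Nullary.Dec (p ≡ q)
_≟Pt_ = ≡-dec _≟ℤ_ _≟ℤ_

Adj : Pt → Pt → Set
Adj a b = ∃ λ d → b ≡ a ⊕ vec d

-- Lists / paths (a path is its list of vertices p[0], p[1], ..., p[|p|])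

_!!_ : {A : Set} → List A → ℕ → Maybe A
[] !! _ = nothing
(x ∷ xs) !! zero = just x
(x ∷ xs) !! suc n = xs !! n

-- number of edges |p|
∣_∣ₚ : List Pt → ℕ
∣ p ∣ₚ = length p ∸ 1

FromTo : List Pt → Pt → Pt → Set
FromTo π x y = (head π ≡ just x) × (last π ≡ just y)

IsSuffix : List Pt → List Pt → Set
IsSuffix s l = ∃ λ xs → l ≡ xs ++ s

IsPrefix : List Pt → List Pt → Set
IsPrefix s l = ∃ λ ys → l ≡ s ++ ys

SimpleGridPath : List Pt → Pt → Pt → Set
SimpleGridPath π x y = FromTo π x y × Unique π × Linked Adj π

Glue : Set
Glue = ℕ × ℕ   -- (label , strength)

-- A singly-seeded TAS at temperature 1 with a finite tile set
record TAS : Set where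
  field
    k        : ℕ
    glue     : Fin k → Dir → Glue
    seedTile : Fin k
    seedPt   : Pt

Tile : TAS → Set
Tile 𝒯 = Fin (TAS.k 𝒯)

Config : TAS → Set
Config 𝒯 = Pt → Maybe (Tile 𝒯)

module _ (𝒯 : TAS) where
  open TAS 𝒯

  InDom : Config 𝒯 → Pt → Set
  InDom α p = ∃ λ t → α p ≡ just t

  -- binding strength between tile t and tile t' placed in direction d from t
  bindStr : Tile 𝒯 → Dir → Tile 𝒯 → ℕ
  bindStr t d t' with ≡-dec _≟ℕ_ _≟ℕ_ (glue t d) (glue t' (opp d))
  ... | yes _ = proj₂ (glue t d)
  ... | no  _ = 0

  nbStr : Config 𝒯 → Pt → Tile 𝒯 → Dir → ℕ
  nbStr α p t d with α (p ⊕ vec d)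
  ... | nothing = 0
  ... | just t' = bindStr t d t'

  totalStr : Config 𝒯 → Pt → Tile 𝒯 → ℕ
  totalStr α p t = nbStr α p t N + nbStr α p t E + nbStr α p t S + nbStr α p t W

  BoundIn : Config 𝒯 → Pt → Pt → Set
  BoundIn α a b = ∃ λ d → (b ≡ a ⊕ vec d) × ∃₂ λ t t' →
                    (α a ≡ just t) × (α b ≡ just t') × (1 ≤ bindStr t d t')

  SimplePathIn : Config 𝒯 → List Pt → Pt → Pt → Set
  SimplePathIn α π x y = FromTo π x y × Unique π × Linked (BoundIn α) π

  CanAttach : Config 𝒯 → Pt → Tile 𝒯 → Set
  CanAttach α p t = (α p ≡ nothing) × (1 ≤ totalStr α p t)

  Step : Config 𝒯 → Config 𝒯 → Pt → Tile 𝒯 → Set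
  Step α β p t = CanAttach α p t × (β p ≡ just t) × (∀ q → q ≢ p → β q ≡ α q)

  AnyStep : Config 𝒯 → Config 𝒯 → Set
  AnyStep α β = ∃₂ λ p t → Step α β p t

  -- u_{α'∖α} = d, where α' = α + (p , t): the new tile binds with total
  -- strength 1, and does so to the tile at p + d
  UVec : Config 𝒯 → Pt → Tile 𝒯 → Dir → Set
  UVec α p t d = (totalStr α p t ≡ 1) × (1 ≤ nbStr α p t d)

  Agree : Config 𝒯 → Config 𝒯 → Set
  Agree α β = ∀ q t t' → α q ≡ just t → β q ≡ just t' → t ≡ t'

  single : Pt → Tile 𝒯 → Config 𝒯
  single x t q with q ≟Pt x
  ... | yes _ = just t
  ... | no  _ = nothing

  σ : Config 𝒯
  σ = single seedPt seedTile

  -- Assembly sequences: finite (bound = just n, assemblies 0..n) or infinite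
  record ASeq : Set where
    field
      f     : ℕ → Config 𝒯
      bound : Maybe ℕ

  InRange : ASeq → ℕ → Set
  InRange s i with ASeq.bound s
  ... | nothing = ⊤
  ... | just n  = i ≤ n

  ValidSeq : ASeq → Set
  ValidSeq s = ∀ i → InRange s (suc i) → AnyStep (ASeq.f s i) (ASeq.f s (suc i))

  Producing : ASeq → Set
  Producing s = ASeq.f s 0 ≗ σ

  ResultOf : ASeq → Config 𝒯 → Set
  ResultOf s α = ∀ q t →
    (α q ≡ just t → ∃ λ i → InRange s i × (ASeq.f s i q ≡ just t)) ×
    ((∃ λ i → InRange s i × (ASeq.f s i q ≡ just t)) → α q ≡ just t)

  Extends : ASeq → ASeq → ℕ → Set
  Extends ᾱ β⃗ n = ∀ i → i ≤ n → InRange ᾱ i × (ASeq.f ᾱ i ≗ ASeq.f β⃗ i)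

  Producible : Config 𝒯 → Set
  Producible α = ∃ λ s → ValidSeq s × Producing s × ResultOf s α

  Terminal : Config 𝒯 → Set
  Terminal α = ∀ p t → ¬ CanAttach α p t

  ProdTerminal : Config 𝒯 → Set
  ProdTerminal α = Producible α × Terminal α

  Reach : Config 𝒯 → Config 𝒯 → Set
  Reach = Star AnyStep

  Compete : Pt → Pt → List Pt → List Pt → Set
  Compete x y π π' =
    SimpleGridPath π x y × SimpleGridPath π' x y ×
    (π ≢ π') ×
    (∀ z → z ∈ π → z ∈ π' → (z ≡ x) ⊎ (z ≡ y)) ×
    (∃ λ α → Producible α × (SimplePathIn α π x y ⊎ SimplePathIn α π' x y)) ×
    (∀ α → Producible α → ∀ p → (p ≡ π) ⊎ (p ≡ π') →
       ∀ l → 1 ≤ l → l < ∣ p ∣ₚ → ∀ z z₁ → p !! l ≡ just z → p !! 1 ≡ just z₁ →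
       ∀ p' → SimplePathIn α p' seedPt z →
         (z₁ ∈ p' → IsSuffix (take l (drop 1 p)) p') ×
         (¬ (z₁ ∈ p') → ∀ q → SimplePathIn α q seedPt z₁ → IsPrefix p' q)) ×
    (∀ α → Producible α → ∀ q → SimplePathIn α q seedPt y →
       IsSuffix π q ⊎ IsSuffix π' q) ×
    (∀ α → Producible α → ∀ tx → α x ≡ just tx →
       (∀ p → (p ≡ π) ⊎ (p ≡ π') →
          ∃ λ c → Reach (single x tx) c × (∀ z → (InDom c z → z ∈ p) × (z ∈ p → InDom c z))) ×
       (∀ c → Reach (single x tx) c → ∀ q → SimplePathIn c q x y → (q ≡ π) ⊎ (q ≡ π')))

  IsPOC : Pt → Set
  IsPOC y = ∃ λ x → (x ≢ y) × ∃₂ λ π π' → Compete x y π π'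

  -- w-correctness, for Y given as a list of points and w : Pt → T
  WCorrect : List Pt → (Pt → Tile 𝒯) → Config 𝒯 → Set
  WCorrect Y w α =
    (∀ p t → p ∈ Y → α p ≡ just t → t ≡ w p) ×
    (∀ p → IsPOC p → InDom α p → p ∈ Y)

  DirDetPoint : Pt → Set
  DirDetPoint p =
    ∀ α β → Producible α → Producible β →
    ∀ tα tβ α' β' → Step α α' p tα → Step β β' p tβ →
      (IsPOC p → tα ≢ tβ →
         ∀ dα dβ → UVec α p tα dα → UVec β p tβ dβ →
           (dα ≢ dβ) ⊎ (α (p ⊕ vec dα) ≢ β (p ⊕ vec dβ))) ×
      (¬ IsPOC p → tα ≢ tβ → ¬ Agree α β)

  DirDet : Set
  DirDet = ∀ p → (∃ λ α → Producible α × InDom α p) → (p ≡ seedPt) ⊎ DirDetPoint p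

{-# OPTIONS --safe #-}
-- Every tile placed by β⃗ agrees with α. A tile t attachable at p to a producible β ⊑ α cannot
-- meet an empty α p, since α is terminal; and if α p = t' ≠ t, then t' was itself attached to
-- some producible γ ⊑ α, and γ, β agree, so directional determinism makes p a point of
-- competition, where w-correctness of both assemblies forces t = w p = t'. Hence the final
-- assembly F of β⃗ lies in a stage s_K of a sequence s producing α, and the assemblies F ∪ s_i,
-- with the steps of s that land inside F dropped, lead from F to s_K, after which s is followed.
module Submission where

open import Defs
open import Function using (_∘_)
open import Data.Nat using (ℕ; zero; suc; _+_; _∸_; _≤_; _<_; _≤′_; ≤′-refl; ≤′-step; z≤n; s≤s)
open import Data.Nat.Properties
  using ( ≤-refl; ≤-trans; ≤-total; <⇒≤; +-mono-≤; m≤n⇒m≤1+n; n≤1+n; ≤⇒≤′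
        ; m∸n+n≡m; m≤o∸n⇒m+n≤o; ∸-monoˡ-≤)
open import Data.Product using (_×_; ∃; ∃₂; _,_; proj₁; proj₂)
open import Data.Sum using (_⊎_; inj₁; inj₂)
open import Data.Maybe using (Maybe; just; nothing; map; _<∣>_)
open import Data.Maybe.Properties using (just-injective)
open import Data.Fin using () renaming (_≟_ to _≟ᶠ_)
open import Data.Empty using (⊥-elim)
open import Data.Unit using (⊤; tt)
open import Data.List using (List; length)
open import Data.List.Membership.Propositional using (_∈_)
open import Data.List.Relation.Unary.All using (All)
open import Data.List.Relation.Unary.Unique.Propositional using (Unique)
open import Relation.Binary.PropositionalEquality using (_≡_; _≢_; _≗_; refl; sym; trans; cong; subst)
open import Relation.Nullary using (¬_; yes; no)

-- InRange of Defs as a function of the bound alone, so that it computes on bounds built with map.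
Within : Maybe ℕ → ℕ → Set
Within nothing  _ = ⊤
Within (just n) i = i ≤ n

Within-0 : ∀ b → Within b 0
Within-0 nothing  = tt
Within-0 (just n) = z≤n

Within-≤ : ∀ b {i j} → Within b j → i ≤ j → Within b i
Within-≤ nothing  _   _   = tt
Within-≤ (just n) j≤n i≤j = ≤-trans i≤j j≤n

Within-suc : ∀ b {i} → Within b i → Within (map suc b) (suc i)
Within-suc nothing  _   = tt
Within-suc (just n) i≤n = s≤s i≤n

Within-pred : ∀ b {i} → Within (map suc b) (suc i) → Within b i
Within-pred nothing  _         = tt
Within-pred (just n) (s≤s i≤n) = i≤n

_+ᵇ_ : ℕ → Maybe ℕ → Maybe ℕ
zero  +ᵇ b = b
suc n +ᵇ b = map suc (n +ᵇ b)

Within-+ᵇ : ∀ n b {i} → i ≤ n → Within (n +ᵇ b) i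
Within-+ᵇ zero    b z≤n       = Within-0 b
Within-+ᵇ (suc n) b z≤n       = Within-0 (map suc (n +ᵇ b))
Within-+ᵇ (suc n) b (s≤s i≤n) = Within-suc (n +ᵇ b) (Within-+ᵇ n b i≤n)

Within-∸ : ∀ b {j} K → Within b j → Within (map (_∸ K) b) (j ∸ K)
Within-∸ nothing  K _   = tt
Within-∸ (just n) K j≤n = ∸-monoˡ-≤ K j≤n

Within-∸⁻¹ : ∀ b {i K} → Within b K → Within (map (_∸ K) b) i → Within b (i + K)
Within-∸⁻¹ nothing  _   _     = tt
Within-∸⁻¹ (just n) {i} K≤n i≤n∸K = m≤o∸n⇒m+n≤o i K≤n i≤n∸K

module Assembly (𝒯 : TAS) where
  open TAS 𝒯 using (seedPt; seedTile)

  private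
    variable
      α β β' γ γ' δ δ' : Config 𝒯
      p : Pt
      t : Tile 𝒯

  infix 4 _⊑_
  _⊑_ : Config 𝒯 → Config 𝒯 → Set
  γ ⊑ δ = ∀ q t → γ q ≡ just t → δ q ≡ just t

  ⊑-refl : γ ⊑ γ
  ⊑-refl _ _ γq = γq

  ⊑-trans : γ ⊑ δ → δ ⊑ α → γ ⊑ α
  ⊑-trans γ⊑δ δ⊑α q t γq = δ⊑α q t (γ⊑δ q t γq)

  ≗⇒⊑ : γ ≗ δ → γ ⊑ δ
  ≗⇒⊑ γ≗δ q t γq = trans (sym (γ≗δ q)) γq

  ⊑⇒Agree : γ ⊑ α → δ ⊑ α → Agree 𝒯 γ δ
  ⊑⇒Agree γ⊑α δ⊑α q t t' γq δq = just-injective (trans (sym (γ⊑α q t γq)) (δ⊑α q t' δq))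

  nbStr-mono : γ ⊑ δ → ∀ p t d → nbStr 𝒯 γ p t d ≤ nbStr 𝒯 δ p t d
  nbStr-mono {γ} γ⊑δ p t d with γ (p ⊕ vec d) in γq
  ... | nothing = z≤n
  ... | just u rewrite γ⊑δ _ u γq = ≤-refl

  totalStr-mono : γ ⊑ δ → ∀ p t → totalStr 𝒯 γ p t ≤ totalStr 𝒯 δ p t
  totalStr-mono {γ} {δ} γ⊑δ p t =
    +-mono-≤ (+-mono-≤ (+-mono-≤ (mono N) (mono E)) (mono S)) (mono W)
    where
      mono : ∀ d → nbStr 𝒯 γ p t d ≤ nbStr 𝒯 δ p t d
      mono = nbStr-mono γ⊑δ p t

  CanAttach-mono : γ ⊑ δ → CanAttach 𝒯 γ p t → δ p ≡ nothing → CanAttach 𝒯 δ p t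
  CanAttach-mono {p = p} {t} γ⊑δ (_ , bound) δp = δp , ≤-trans bound (totalStr-mono γ⊑δ p t)

  AnyStep-resp-≗ : AnyStep 𝒯 γ γ' → γ ≗ δ → γ' ≗ δ' → AnyStep 𝒯 δ δ'
  AnyStep-resp-≗ (p , t , (att , γ'p , rest)) γ≗δ γ'≗δ' =
    p , t , CanAttach-mono (≗⇒⊑ γ≗δ) att (trans (sym (γ≗δ p)) (proj₁ att)) ,
    trans (sym (γ'≗δ' p)) γ'p ,
    λ q q≢p → trans (sym (γ'≗δ' q)) (trans (rest q q≢p) (γ≗δ q))

  Step⇒⊑ : Step 𝒯 γ γ' p t → γ ⊑ γ'
  Step⇒⊑ {p = p} ((γp , _) , _ , rest) q u γq with q ≟Pt p
  ... | yes refl with () ← trans (sym γp) γq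
  ... | no q≢p = trans (rest q q≢p) γq

  Step-fresh : Step 𝒯 γ γ' p t → ∀ {q u} → γ q ≡ nothing → γ' q ≡ just u → q ≡ p × u ≡ t
  Step-fresh {p = p} (_ , γ'p , rest) {q} γq γ'q with q ≟Pt p
  ... | yes refl = refl , just-injective (trans (sym γ'q) γ'p)
  ... | no q≢p with () ← trans (sym γq) (trans (sym (rest q q≢p)) γ'q)

  Step-⊑ : Step 𝒯 γ γ' p t → γ ⊑ δ → δ p ≡ just t → γ' ⊑ δ
  Step-⊑ {p = p} (_ , γ'p , rest) γ⊑δ δp q u γ'q with q ≟Pt p
  ... | yes refl = trans δp (cong just (just-injective (trans (sym γ'p) γ'q)))
  ... | no q≢p = γ⊑δ q u (trans (sym (rest q q≢p)) γ'q)

  infixl 6 _∪_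
  _∪_ : Config 𝒯 → Config 𝒯 → Config 𝒯
  (γ ∪ δ) q = γ q <∣> δ q

  ∪-outsideˡ : ∀ γ δ → γ p ≡ nothing → (γ ∪ δ) p ≡ δ p
  ∪-outsideˡ _ _ γp rewrite γp = refl

  ∪-absorbˡ : γ ⊑ δ → γ ∪ δ ≗ δ
  ∪-absorbˡ {γ} γ⊑δ q with γ q in γq
  ... | just u  = sym (γ⊑δ q u γq)
  ... | nothing = refl

  ∪-absorbʳ : δ ⊑ γ → γ ∪ δ ≗ γ
  ∪-absorbʳ {δ} {γ} δ⊑γ q with γ q in γq | δ q in δq
  ... | just _  | _       = refl
  ... | nothing | nothing = refl
  ... | nothing | just u  with () ← trans (sym γq) (δ⊑γ q u δq)

  ⊑-∪ʳ : Agree 𝒯 γ δ → δ ⊑ γ ∪ δ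
  ⊑-∪ʳ {γ} agree q u δq with γ q in γq
  ... | just v  = cong just (agree q v u γq δq)
  ... | nothing = δq

  ∪-Step : Agree 𝒯 γ δ → Step 𝒯 δ δ' p t → γ p ≡ nothing → Step 𝒯 (γ ∪ δ) (γ ∪ δ') p t
  ∪-Step {γ} {δ} {δ'} agree (att@(δp , _) , δ'p , rest) γp =
    CanAttach-mono (⊑-∪ʳ agree) att (trans (∪-outsideˡ γ δ γp) δp) ,
    trans (∪-outsideˡ γ δ' γp) δ'p ,
    λ q q≢p → cong (γ q <∣>_) (rest q q≢p)

  ∪-stutter : Step 𝒯 δ δ' p t → ∀ {v} → γ p ≡ just v → γ ∪ δ' ≗ γ ∪ δ
  ∪-stutter {p = p} {γ = γ} (_ , _ , rest) γp q with q ≟Pt p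
  ... | yes refl rewrite γp = refl
  ... | no q≢p = cong (γ q <∣>_) (rest q q≢p)

  InRange⇒Within : ∀ s {i} → InRange 𝒯 s i → Within (ASeq.bound s) i
  InRange⇒Within s r with ASeq.bound s
  ... | nothing = tt
  ... | just _  = r

  Within⇒InRange : ∀ s {i} → Within (ASeq.bound s) i → InRange 𝒯 s i
  Within⇒InRange s r with ASeq.bound s
  ... | nothing = tt
  ... | just _  = r

  σ-seed : σ 𝒯 seedPt ≡ just seedTile
  σ-seed with seedPt ≟Pt seedPt
  ... | yes _ = refl
  ... | no seedPt≢seedPt = ⊥-elim (seedPt≢seedPt refl)

  σ-outside : p ≢ seedPt → σ 𝒯 p ≡ nothing
  σ-outside {p} p≢seed with p ≟Pt seedPt
  ... | yes p≡seed = ⊥-elim (p≢seed p≡seed)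
  ... | no _ = refl

  Valid : (ℕ → Config 𝒯) → Maybe ℕ → Set
  Valid g b = ∀ i → Within b (suc i) → AnyStep 𝒯 (g i) (g (suc i))

  Result : (ℕ → Config 𝒯) → Maybe ℕ → Config 𝒯 → Set
  Result g b α =
    (∀ i → Within b i → g i ⊑ α) × (∀ q t → α q ≡ just t → ∃ λ i → Within b i × g i q ≡ just t)

  ValidSeq⇒Valid : ∀ s → ValidSeq 𝒯 s → Valid (ASeq.f s) (ASeq.bound s)
  ValidSeq⇒Valid s valid i r = valid i (Within⇒InRange s r)

  Valid⇒ValidSeq : ∀ s → Valid (ASeq.f s) (ASeq.bound s) → ValidSeq 𝒯 s
  Valid⇒ValidSeq s valid i r = valid i (InRange⇒Within s r)

  ResultOf⇒Result : ∀ s → ResultOf 𝒯 s α → Result (ASeq.f s) (ASeq.bound s) α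
  ResultOf⇒Result s res =
    (λ i r q t sᵢq → proj₂ (res q t) (i , Within⇒InRange s r , sᵢq)) ,
    λ q t αq → let (i , r , sᵢq) = proj₁ (res q t) αq in i , InRange⇒Within s r , sᵢq

  Result⇒ResultOf : ∀ s → Result (ASeq.f s) (ASeq.bound s) α → ResultOf 𝒯 s α
  Result⇒ResultOf s (s⊑α , covers) q t =
    (λ αq → let (i , r , sᵢq) = covers q t αq in i , Within⇒InRange s r , sᵢq) ,
    λ (i , r , sᵢq) → s⊑α i (InRange⇒Within s r) q t sᵢq

  Valid-mono : ∀ {g} b → Valid g b → ∀ {i j} → i ≤ j → Within b j → g i ⊑ g j
  Valid-mono {g} b valid i≤j = go (≤⇒≤′ i≤j)
    where
      go : ∀ {i j} → i ≤′ j → Within b j → g i ⊑ g j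
      go ≤′-refl _ = ⊑-refl
      go (≤′-step {j} i≤′j) r =
        ⊑-trans (go i≤′j (Within-≤ b r (n≤1+n j))) (Step⇒⊑ (proj₂ (proj₂ (valid j r))))

  σ⊑ : Producible 𝒯 γ → σ 𝒯 ⊑ γ
  σ⊑ (s , _ , s₀≗σ , res) q t σq =
    proj₂ (res q t) (0 , Within⇒InRange s (Within-0 (ASeq.bound s)) , trans (s₀≗σ q) σq)

  prefix-producible : ∀ {g} b → Valid g b → g 0 ≗ σ 𝒯 → ∀ {k} → Within b k → Producible 𝒯 (g k)
  prefix-producible {g} b valid g₀≗σ {k} r =
    record { f = g ; bound = just k } , (λ i i<k → valid i (Within-≤ b r i<k)) , g₀≗σ ,
    λ q t → (λ gₖq → k , ≤-refl , gₖq) , λ (i , i≤k , gᵢq) → Valid-mono b valid i≤k r q t gᵢq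

  first-attachment : ∀ {g} b → Valid g b → ∀ {i q u} → Within b i → g i q ≡ just u → g 0 q ≡ nothing →
                     ∃ λ k → k < i × Step 𝒯 (g k) (g (suc k)) q u
  first-attachment b valid {zero} _ g₀q g₀q≡nothing with () ← trans (sym g₀q≡nothing) g₀q
  first-attachment {g} b valid {suc i} {q} r gᵢ₊₁q g₀q with g i q in gᵢq | valid i r
  ... | nothing | _ , _ , st with refl , refl ← Step-fresh st gᵢq gᵢ₊₁q = i , ≤-refl , st
  ... | just v  | _ , _ , st with refl ← just-injective (trans (sym (Step⇒⊑ st q v gᵢq)) gᵢ₊₁q) =
    let (k , k<i , stₖ) = first-attachment b valid (Within-≤ b r (n≤1+n i)) gᵢq g₀q
    in k , m≤n⇒m≤1+n k<i , stₖ

  attachment-in-sequence : ∀ {g} b → Valid g b → g 0 ≗ σ 𝒯 → Result g b α → α p ≡ just t → p ≢ seedPt →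
    ∃₂ λ γ γ' → Producible 𝒯 γ × γ ⊑ α × Step 𝒯 γ γ' p t
  attachment-in-sequence {p = p} {t} {g} b valid g₀≗σ (g⊑α , covers) αp p≢seed
    with covers p t αp
  ... | i , rᵢ , gᵢp with first-attachment b valid rᵢ gᵢp (trans (g₀≗σ p) (σ-outside p≢seed))
  ...   | k , k<i , st = g k , g (suc k) , prefix-producible b valid g₀≗σ rₖ , g⊑α k rₖ , st
    where
      rₖ : Within b k
      rₖ = Within-≤ b rᵢ (<⇒≤ k<i)

  attachment-in-producible : Producible 𝒯 α → α p ≡ just t → p ≢ seedPt →
    ∃₂ λ γ γ' → Producible 𝒯 γ × γ ⊑ α × Step 𝒯 γ γ' p t
  attachment-in-producible (s , valid , s₀≗σ , res) =
    attachment-in-sequence (ASeq.bound s) (ValidSeq⇒Valid s valid) s₀≗σ (ResultOf⇒Result s res)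

  infixr 5 _◂_
  _◂_ : Config 𝒯 → (ℕ → Config 𝒯) → ℕ → Config 𝒯
  (γ ◂ g) zero    = γ
  (γ ◂ g) (suc i) = g i

  Valid-◂ : ∀ {g} b → AnyStep 𝒯 γ (g 0) → Valid g b → Valid (γ ◂ g) (map suc b)
  Valid-◂ b st valid zero    _ = st
  Valid-◂ b st valid (suc i) r = valid i (Within-pred b r)

  Result-◂ : ∀ {g} b → γ ⊑ α → Result g b α → Result (γ ◂ g) (map suc b) α
  Result-◂ b γ⊑α (g⊑α , covers) =
    (λ { zero _ → γ⊑α ; (suc i) r → g⊑α i (Within-pred b r) }) ,
    λ q t αq → let (i , r , gᵢq) = covers q t αq in suc i , Within-suc b r , gᵢq

  splice : ℕ → (ℕ → Config 𝒯) → (ℕ → Config 𝒯) → ℕ → Config 𝒯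
  splice zero    a g = g
  splice (suc n) a g = a 0 ◂ splice n (a ∘ suc) g

  splice-agrees : ∀ n {a g} → g 0 ≗ a n → ∀ {i} → i ≤ n → splice n a g i ≗ a i
  splice-agrees zero    g₀≗aₙ z≤n         = g₀≗aₙ
  splice-agrees (suc n) g₀≗aₙ {zero}  _   = λ _ → refl
  splice-agrees (suc n) g₀≗aₙ {suc i} (s≤s i≤n) = splice-agrees n g₀≗aₙ i≤n

  splice-valid : ∀ n {a g} b → Valid a (just n) → Valid g b → g 0 ≗ a n → Valid (splice n a g) (n +ᵇ b)
  splice-valid zero    b _     valid _     = valid
  splice-valid (suc n) b chain valid g₀≗aₙ =
    Valid-◂ (n +ᵇ b)
      (AnyStep-resp-≗ (chain 0 (s≤s z≤n)) (λ _ → refl) (λ q → sym (splice-agrees n g₀≗aₙ z≤n q)))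
      (splice-valid n b (λ i i<n → chain (suc i) (s≤s i<n)) valid g₀≗aₙ)

  splice-result : ∀ n {a g} b → Valid a (just n) → g 0 ≗ a n → Result g b α →
                  Result (splice n a g) (n +ᵇ b) α
  splice-result zero    b _     _     res = res
  splice-result (suc n) b chain g₀≗aₙ res@(g⊑α , _) =
    Result-◂ (n +ᵇ b)
      (⊑-trans (Valid-mono (just (suc n)) chain z≤n ≤-refl)
               (⊑-trans (≗⇒⊑ (λ q → sym (g₀≗aₙ q))) (g⊑α 0 (Within-0 b))))
      (splice-result n b (λ i i<n → chain (suc i) (s≤s i<n)) g₀≗aₙ res)

  Valid-shift : ∀ {g} b K → Valid g b → Within b K → Valid (λ i → g (i + K)) (map (_∸ K) b)
  Valid-shift b K valid rK i r = valid (i + K) (Within-∸⁻¹ b rK r)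

  Result-shift : ∀ {g} b K → Valid g b → Within b K → Result g b α →
                 Result (λ i → g (i + K)) (map (_∸ K) b) α
  Result-shift {α} {g} b K valid rK (g⊑α , covers) =
    (λ i r → g⊑α (i + K) (Within-∸⁻¹ b rK r)) , λ q t αq → from-K (covers q t αq)
    where
      from-K : ∀ {q t} → (∃ λ j → Within b j × g j q ≡ just t) →
               ∃ λ i → Within (map (_∸ K) b) i × g (i + K) q ≡ just t
      from-K {q} (j , rⱼ , gⱼq) with ≤-total j K
      ... | inj₁ j≤K = 0 , Within-0 (map (_∸ K) b) , Valid-mono b valid j≤K rK q _ gⱼq
      ... | inj₂ K≤j = j ∸ K , Within-∸ b K rⱼ , subst (λ l → g l q ≡ just _) (sym (m∸n+n≡m K≤j)) gⱼq

  Stuttering : (ℕ → Config 𝒯) → ℕ → Set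
  Stuttering h K = ∀ i → i < K → h (suc i) ≗ h i ⊎ AnyStep 𝒯 (h i) (h (suc i))

  destutter : ∀ K h → Stuttering h K → ∃₂ λ m c → Valid c (just m) × c 0 ≗ h 0 × c m ≗ h K
  destutter zero    h _    = 0 , h , (λ _ ()) , (λ _ → refl) , (λ _ → refl)
  destutter (suc K) h stut
    with destutter K (h ∘ suc) (λ i i<K → stut (suc i) (s≤s i<K)) | stut 0 (s≤s z≤n)
  ... | m , c , chain , c₀≗h₁ , cₘ≗hₖ | inj₁ h₁≗h₀ =
    m , c , chain , (λ q → trans (c₀≗h₁ q) (h₁≗h₀ q)) , cₘ≗hₖ
  ... | m , c , chain , c₀≗h₁ , cₘ≗hₖ | inj₂ st =
    suc m , h 0 ◂ c , Valid-◂ (just m) (AnyStep-resp-≗ st (λ _ → refl) (λ q → sym (c₀≗h₁ q))) chain ,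
    (λ _ → refl) , cₘ≗hₖ

  ∪-Stuttering : ∀ {g} b → Valid g b → (∀ i → Within b i → g i ⊑ α) → γ ⊑ α →
                 ∀ {K} → Within b K → Stuttering (λ i → γ ∪ g i) K
  ∪-Stuttering {γ = γ} b valid g⊑α γ⊑α rK i i<K with valid i (Within-≤ b rK i<K)
  ... | p , t , st with γ p in γp
  ...   | just _  = inj₁ (∪-stutter st γp)
  ...   | nothing = inj₂ (p , t , ∪-Step (⊑⇒Agree γ⊑α (g⊑α i (Within-≤ b rK (<⇒≤ i<K)))) st γp)

  -- Steps of g inside γ are stutters of γ ∪ g i, and from stage K on γ ∪ g i is g i.
  continue-from : ∀ {g} b → Valid g b → Result g b α → g 0 ⊑ γ → γ ⊑ α → ∀ {K} → Within b K → γ ⊑ g K →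
            ∃₂ λ g' b' → Valid g' b' × g' 0 ≗ γ × Result g' b' α
  continue-from {γ = γ} {g} b valid res@(g⊑α , _) g₀⊑γ γ⊑α {K} rK γ⊑gₖ
    with destutter K (λ i → γ ∪ g i) (∪-Stuttering b valid g⊑α γ⊑α rK)
  ... | m , c , chain , c₀≗γ∪g₀ , cₘ≗γ∪gₖ =
    splice m c (λ i → g (i + K)) , m +ᵇ map (_∸ K) b ,
    splice-valid m _ chain (Valid-shift b K valid rK) gₖ≗cₘ ,
    (λ q → trans (splice-agrees m gₖ≗cₘ z≤n q) (trans (c₀≗γ∪g₀ q) (∪-absorbʳ g₀⊑γ q))) ,
    splice-result m _ chain gₖ≗cₘ (Result-shift b K valid rK res)
    where
      gₖ≗cₘ : g K ≗ c m
      gₖ≗cₘ q = sym (trans (cₘ≗γ∪gₖ q) (∪-absorbˡ γ⊑gₖ q))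

  attach-away-from-seed : Producible 𝒯 β → CanAttach 𝒯 β p t → p ≢ seedPt
  attach-away-from-seed prodβ (βp , _) refl with () ← trans (sym βp) (σ⊑ prodβ seedPt seedTile σ-seed)

  disagreement-at-POC : DirDet 𝒯 → Producible 𝒯 α → Producible 𝒯 β → β ⊑ α →
    Step 𝒯 β β' p t → ∀ {t'} → α p ≡ just t' → t' ≢ t → ¬ ¬ IsPOC 𝒯 p
  disagreement-at-POC {α} {β} {β'} {p} {t} dd prodα prodβ β⊑α st@(att , _) {t'} αp t'≢t ¬poc
    with dd p (α , prodα , t' , αp)
  ... | inj₁ p≡seed = attach-away-from-seed prodβ att p≡seed
  ... | inj₂ dirdet with attachment-in-producible prodα αp (attach-away-from-seed prodβ att)
  ...   | γ , γ' , prodγ , γ⊑α , stγ =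
    proj₂ (dirdet γ β prodγ prodβ t' t γ' β' stγ st) ¬poc t'≢t (⊑⇒Agree γ⊑α β⊑α)

  attach-⊑-terminal : DirDet 𝒯 → Producible 𝒯 α → Terminal 𝒯 α → Producible 𝒯 β → β ⊑ α →
    Step 𝒯 β β' p t → (IsPOC 𝒯 p → ∀ {t'} → α p ≡ just t' → t' ≡ t) → α p ≡ just t
  attach-⊑-terminal {α} {p = p} {t} dd prodα termα prodβ β⊑α st@(att , _) winner with α p in αp
  ... | nothing = ⊥-elim (termα p t (CanAttach-mono β⊑α att αp))
  ... | just t' with t' ≟ᶠ t
  ...   | yes t'≡t = cong just t'≡t
  ...   | no t'≢t =
    ⊥-elim (disagreement-at-POC dd prodα prodβ β⊑α st αp t'≢t (λ poc → t'≢t (winner poc refl)))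

  chain-⊑-terminal : DirDet 𝒯 → Producible 𝒯 α → Terminal 𝒯 α →
    ∀ {a n} → Valid a (just n) → a 0 ≗ σ 𝒯 →
    (∀ {p t t'} → a n p ≡ just t → IsPOC 𝒯 p → α p ≡ just t' → t' ≡ t) →
    ∀ {j} → j ≤ n → a j ⊑ α
  chain-⊑-terminal dd prodα termα chain a₀≗σ winner {zero} _ = ⊑-trans (≗⇒⊑ a₀≗σ) (σ⊑ prodα)
  chain-⊑-terminal {α} dd prodα termα {a} {n} chain a₀≗σ winner {suc j} j<n with chain j j<n
  ... | p , t , st@(_ , aⱼ₊₁p , _) =
    Step-⊑ st aⱼ⊑α
      (attach-⊑-terminal dd prodα termα (prefix-producible (just n) chain a₀≗σ (<⇒≤ j<n)) aⱼ⊑α st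
        (λ poc → winner (Valid-mono (just n) chain j<n ≤-refl p t aⱼ₊₁p) poc))
    where
      aⱼ⊑α : a j ⊑ α
      aⱼ⊑α = chain-⊑-terminal dd prodα termα chain a₀≗σ winner (<⇒≤ j<n)

  chain-⊑-stage : ∀ {g} b → Valid g b → Result g b α →
    ∀ {a n} → Valid a (just n) → a 0 ⊑ g 0 → (∀ {j} → j ≤ n → a j ⊑ α) →
    ∀ {j} → j ≤ n → ∃ λ K → Within b K × a j ⊑ g K
  chain-⊑-stage b valid res chain a₀⊑g₀ a⊑α {zero} _ = 0 , Within-0 b , a₀⊑g₀
  chain-⊑-stage b valid res@(_ , covers) chain a₀⊑g₀ a⊑α {suc j} j<n
    with chain-⊑-stage b valid res chain a₀⊑g₀ a⊑α (<⇒≤ j<n) | chain j j<n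
  ... | K , rₖ , aⱼ⊑gₖ | p , t , st@(_ , aⱼ₊₁p , _) with covers p t (a⊑α j<n p t aⱼ₊₁p)
  ...   | i , rᵢ , gᵢp with ≤-total K i
  ...     | inj₁ K≤i = i , rᵢ , Step-⊑ st (⊑-trans aⱼ⊑gₖ (Valid-mono b valid K≤i rᵢ)) gᵢp
  ...     | inj₂ i≤K = K , rₖ , Step-⊑ st aⱼ⊑gₖ (Valid-mono b valid i≤K rₖ p t gᵢp)

  extension-to-terminal : DirDet 𝒯 → Producible 𝒯 α → Terminal 𝒯 α →
    ∀ {a n} → Valid a (just n) → a 0 ≗ σ 𝒯 →
    (∀ {p t t'} → a n p ≡ just t → IsPOC 𝒯 p → α p ≡ just t' → t' ≡ t) →
    ∃₂ λ g b → Valid g b × (∀ i → i ≤ n → Within b i × g i ≗ a i) × Result g b α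
  extension-to-terminal {α} dd prodα@(s , validₛ , s₀≗σ , resₛ) termα {a} {n} chain a₀≗σ winner =
    let (K , rₖ , aₙ⊑sₖ) = chain-⊑-stage b Vₛ Rₛ chain a₀⊑s₀ a⊑α ≤-refl
        (g , b' , valid , g₀≗aₙ , res) = continue-from b Vₛ Rₛ s₀⊑aₙ (a⊑α ≤-refl) rₖ aₙ⊑sₖ
    in splice n a g , n +ᵇ b' , splice-valid n b' chain valid g₀≗aₙ ,
       (λ i i≤n → Within-+ᵇ n b' i≤n , splice-agrees n g₀≗aₙ i≤n) ,
       splice-result n b' chain g₀≗aₙ res
    where
      b : Maybe ℕ
      b = ASeq.bound s
      Vₛ : Valid (ASeq.f s) b
      Vₛ = ValidSeq⇒Valid s validₛ
      Rₛ : Result (ASeq.f s) b α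
      Rₛ = ResultOf⇒Result s resₛ
      a⊑α : ∀ {j} → j ≤ n → a j ⊑ α
      a⊑α = chain-⊑-terminal dd prodα termα chain a₀≗σ winner
      a₀⊑s₀ : a 0 ⊑ ASeq.f s 0
      a₀⊑s₀ = ≗⇒⊑ (λ q → trans (a₀≗σ q) (sym (s₀≗σ q)))
      s₀⊑aₙ : ASeq.f s 0 ⊑ a n
      s₀⊑aₙ = ⊑-trans (≗⇒⊑ (λ q → trans (s₀≗σ q) (sym (a₀≗σ q))))
                      (Valid-mono (just n) chain z≤n ≤-refl)

lemma3 : (𝒯 : TAS) (r : ℕ) (Y : List Pt) (w : Pt → Tile 𝒯) →
    1 ≤ r → Unique Y → length Y ≡ r → All (IsPOC 𝒯) Y →
    DirDet 𝒯 →
    (α : Config 𝒯) → ProdTerminal 𝒯 α → WCorrect 𝒯 Y w α →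
    (∀ α' → ProdTerminal 𝒯 α' → WCorrect 𝒯 Y w α' → α' ≗ α) →
    (β⃗ : ASeq 𝒯) (n : ℕ) → ASeq.bound β⃗ ≡ just n →
    ValidSeq 𝒯 β⃗ → Producing 𝒯 β⃗ →
    WCorrect 𝒯 Y w (ASeq.f β⃗ n) →
    ¬ ProdTerminal 𝒯 (ASeq.f β⃗ n) →
    ∃ λ (ᾱ : ASeq 𝒯) → ValidSeq 𝒯 ᾱ × Extends 𝒯 ᾱ β⃗ n × ResultOf 𝒯 ᾱ α
lemma3 𝒯 _ Y w _ _ _ _ dd α (prodα , termα) (wα , _) _ β⃗ n bound≡n validβ β₀≗σ (wβ , poc∈Y) _ =
  let (g , b , valid , agrees , res) = extension-to-terminal dd prodα termα chain β₀≗σ winner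
      ᾱ : ASeq 𝒯
      ᾱ = record { f = g ; bound = b }
  in ᾱ , Valid⇒ValidSeq ᾱ valid ,
     (λ i i≤n → let (r , gᵢ≗βᵢ) = agrees i i≤n in Within⇒InRange ᾱ r , gᵢ≗βᵢ) ,
     Result⇒ResultOf ᾱ res
  where
    open Assembly 𝒯
    chain : Valid (ASeq.f β⃗) (just n)
    chain = subst (Valid (ASeq.f β⃗)) bound≡n (ValidSeq⇒Valid β⃗ validβ)
    winner : ∀ {p t t'} → ASeq.f β⃗ n p ≡ just t → IsPOC 𝒯 p → α p ≡ just t' → t' ≡ t
    winner {p} βₙp poc αp = trans (wα _ _ p∈Y αp) (sym (wβ _ _ p∈Y βₙp))
      where
        p∈Y : p ∈ Y
        p∈Y = poc∈Y p poc (_ , βₙp)
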